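{- Let $G$ be a connected MO-graph with $V$ vertices, degree $\delta$ and genus $g$. Let $F_s$ be the number of straight faces of $G$, and for each $p\ge 1$ let $F_s^{(p)}$ be the number of straight faces of length $2p$. Then $$\Lambda:=\sum_{p\ge 1}(p-2)F_s^{(p)}+2=V-2F_s+2$$ satisfies $\Lambda=2\delta-4g$. In particular $\Lambda\le 2\delta$.
   Context: A map is a graph (loops and multiple edges allowed) together with, at each vertex, a cyclic (clockwise) order of the incident half-edges. An MO-graph (multi-orientable tensor graph) is a 4-regular map whose edges are oriented so that at every vertex the two outgoing half-edges are opposite (non-consecutive in the cyclic order) and the two incoming half-edges are opposite. The faces of an MO-graph are of three kinds: the faces of the underlying map, each of which is either a left face (all its edges directed counterclockwise around it) or a right face (all its edges directed clockwise around it); and the straight faces, i.e. closed walks which at each vertex leave through the half-edge opposite to the one through which they arrived (straight faces have even length). The length of a face is its number of edges counted with multiplicity. The degree $\delta\in\tfrac12\mathbb{Z}_{\ge0}$ of an MO-graph is defined by $2\delta=6c+3V-2F$, where $c,V,F$ are the numbers of connected components, vertices and faces (left, right and straight together). The genus $g$ of a connected MO-graph is the genus of its underlying (orientable) map. -}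

module Defs where

open import Data.Nat using (ℕ; zero; suc; _+_; _*_; _≤ᵇ_; _≡ᵇ_; _≤_)
open import Data.Fin using (Fin; zero; suc; toℕ)
open import Data.Bool using (Bool; true; false; not; _∧_; T)
open import Data.Product using (_×_; _,_; proj₁; proj₂)
open import Data.List using (List; []; _∷_; length; filter; map; concatMap; upTo; allFin; foldr)
open import Data.Integer using (ℤ; +_) renaming (_+_ to _+ℤ_; _*_ to _*ℤ_; _-_ to _-ℤ_)
open import Relation.Binary.PropositionalEquality using (_≡_; _≢_)
open import Relation.Nullary.Decidable using (does)
open import Data.Bool.Properties using (T?)

-- Darts (half-edges) of a 4-regular map on V vertices.
-- The dart (v , j) is the j-th half-edge at vertex v in the clockwise
-- cyclic order around v (j ∈ {0,1,2,3}).  So the vertex rotation is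
-- fixed: σ (v , j) = (v , j+1 mod 4).

Dart : ℕ → Set
Dart V = Fin V × Fin 4

rot4 : Fin 4 → Fin 4
rot4 zero = suc zero
rot4 (suc zero) = suc (suc zero)
rot4 (suc (suc zero)) = suc (suc (suc zero))
rot4 (suc (suc (suc zero))) = zero

σ : ∀ {V} → Dart V → Dart V
σ (v , j) = (v , rot4 j)

opp : ∀ {V} → Dart V → Dart V
opp h = σ (σ h)

-- MO-graphs.  'α' is the edge involution (fixed-point free, loops and
-- multiple edges allowed); 'out h' says whether the half-edge h is
-- outgoing for the orientation of its edge.

record MOGraph (V : ℕ) : Set where
  field
    α         : Dart V → Dart V
    α-invol   : ∀ h → α (α h) ≡ h
    α-nofix   : ∀ h → α h ≢ h
    out       : Dart V → Bool
    out-edge  : ∀ h → out (α h) ≡ not (out h)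
    -- consecutive half-edges around a vertex have opposite status; this is
    -- equivalent to: the two outgoing half-edges are opposite and the two
    -- incoming half-edges are opposite.
    out-alt   : ∀ h → out (σ h) ≡ not (out h)

iter : ∀ {A : Set} → (A → A) → ℕ → A → A
iter f zero x = x
iter f (suc k) x = f (iter f k x)

darts : (V : ℕ) → List (Dart V)
darts V = concatMap (λ v → map (λ j → (v , j)) (allFin 4)) (allFin V)

key : ∀ {V} → Dart V → ℕ
key (v , j) = toℕ v * 4 + toℕ j

allL : ∀ {A : Set} → (A → Bool) → List A → Bool
allL P [] = true
allL P (x ∷ xs) = P x ∧ allL P xs

count : ∀ {A : Set} → (A → Bool) → List A → ℕ
count P xs = length (filter (λ x → T? (P x)) xs)

N : ℕ → ℕ
N V = 4 * V

-- Least k ∈ {1,…,n} with f^k h = h (the length of the f-orbit of h when f is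
-- a permutation of a set of size n); returns 0 if none.
firstReturn : ∀ {V} → (Dart V → Dart V) → Dart V → List ℕ → ℕ
firstReturn f h [] = 0
firstReturn f h (k ∷ ks) with key (iter f k h) ≡ᵇ key h
... | true  = k
... | false = firstReturn f h ks

orbitLen : ∀ {V} → (Dart V → Dart V) → Dart V → ℕ
orbitLen {V} f h = firstReturn f h (map suc (upTo (N V)))

module _ {V : ℕ} (G : MOGraph V) where
  open MOGraph G

  φ : Dart V → Dart V
  φ h = σ (α h)

  -- straight-face permutation: arriving at a vertex through h, leave through
  -- opp h and arrive at the other end α (opp h).
  τ : Dart V → Dart V
  τ h = α (opp h)

  isMapFaceRep : Dart V → Bool
  isMapFaceRep h = allL (λ k → key h ≤ᵇ key (iter φ k h)) (upTo (N V))

  -- A straight face is an (undirected) closed walk; its two traversal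
  -- directions are the τ-orbit of h and the τ-orbit of opp h.  h is the
  -- representative of its straight face if it has minimal key among the
  -- arrival half-edges of both traversals.
  isStraightRep : Dart V → Bool
  isStraightRep h =
    allL (λ k → (key h ≤ᵇ key (iter τ k h)) ∧ (key h ≤ᵇ key (opp (iter τ k h))))
        (upTo (N V))

  -- numbers of faces of the underlying map (left + right faces)
  Fmap : ℕ
  Fmap = count isMapFaceRep (darts V)

  Fs : ℕ
  Fs = count isStraightRep (darts V)

  straightLen : Dart V → ℕ
  straightLen h = orbitLen τ h

  Fsp : ℕ → ℕ
  Fsp p = count (λ h → isStraightRep h ∧ (straightLen h ≡ᵇ 2 * p)) (darts V)

  Ftot : ℕ
  Ftot = Fmap + Fs

  -- 2δ = 6c + 3V - 2F with c = 1 (connected)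
  twoδ : ℤ
  twoδ = (+ 6) +ℤ (+ (3 * V)) -ℤ (+ (2 * Ftot))

  -- Λ = Σ_{p ≥ 1} (p - 2) F_s^(p) + 2.  Straight faces have length at most
  -- the number of darts 4V, so F_s^(p) = 0 for p > 4V and the sum over
  -- 1 ≤ p ≤ 4V is the full sum.
  Λ : ℤ
  Λ = foldr (λ p acc → ((+ p) -ℤ (+ 2)) *ℤ (+ (Fsp p)) +ℤ acc) (+ 0)
            (map suc (upTo (N V)))
      +ℤ (+ 2)

  data Reach : Dart V → Dart V → Set where
    here  : ∀ {h} → Reach h h
    viaσ  : ∀ {h h'} → Reach (σ h) h' → Reach h h'
    viaα  : ∀ {h h'} → Reach (α h) h' → Reach h h'

  Connected : Set
  Connected = 1 ≤ V × (∀ h h' → Reach h h')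

  -- g is the genus of the (connected, orientable) underlying map:
  -- Euler's formula V - E + F_map = 2 - 2g with E = 2V edges.
  IsGenus : ℕ → Set
  IsGenus g = V + Fmap + 2 * g ≡ 2 + 2 * V

module Submission where

-- A straight face is traversed by τ = α ∘ opp in two directions: the τ-orbit of a dart h
-- and that of opp h.  Since τ reverses the orientation status of a half-edge, τ-orbits
-- have even length and a τ-orbit never contains both d and opp d.  Hence, if every
-- straight face is represented by one dart, the τ-orbits of the representatives contain
-- exactly one dart of each pair {d, opp d}, so their lengths add up to 2V, i.e.
-- Σₚ p F_s^(p) = V; since also Σₚ F_s^(p) = F_s, Λ = V − 2F_s + 2.  Euler's formula
-- V − 2V + F_map = 2 − 2g then turns this into 2δ − 4g.

open import Defs
open import Data.Nat using (ℕ; _*_)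
open import Data.Product using (_×_)
open import Data.Integer using (+_; _+_; _-_; _≤_)
open import Relation.Binary.PropositionalEquality using (_≡_)

open import Data.Bool using (Bool; true; false; not; _∧_; T; if_then_else_)
open import Data.Bool.Properties using (T-∧; not-¬; not-involutive)
open import Data.Empty using (⊥-elim)
open import Data.Fin using (Fin; zero; suc; toℕ; combine)
import Data.Fin.Properties as Fin
import Data.Integer as ℤ
import Data.Integer.Properties as ℤ
import Data.Integer.Tactic.RingSolver as ℤ
open import Data.List
  using (List; []; _∷_; _++_; map; length; cartesianProduct; concatMap; allFin; applyUpTo; upTo; foldr)
open import Data.List.Extrema.Nat using (argmin; argmin-all; f[argmin]≤f[xs])
open import Data.List.Membership.Propositional using (_∈_; lose)
open import Data.List.Membership.Propositional.Properties
  using (∈-cartesianProduct⁺; ∈-allFin; ∈-upTo⁺; ∈-upTo⁻; ∈-map⁺; ∈-map⁻; ∈-++⁺ˡ; ∈-++⁺ʳ; ∈-++⁻)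
open import Data.List.Properties using (length-tabulate; length-upTo; map-upTo)
open import Data.List.Relation.Unary.All as All using (All; []; _∷_)
open import Data.List.Relation.Unary.Any using (here; there; any?; satisfied)
open import Data.List.Relation.Unary.Unique.Propositional using (Unique; []; _∷_)
import Data.List.Relation.Unary.Unique.Propositional.Properties as Unique
open import Data.Nat as ℕ using (zero; suc; _≤ᵇ_; _≡ᵇ_; _<_; _∸_; ⌊_/2⌋; NonZero)
open import Data.Nat.DivMod using (_%_; _/_; m≡m%n+[m/n]*n; m%n<n)
import Data.Nat.Properties as ℕ
open import Algebra.Properties.CommutativeSemigroup ℕ.+-commutativeSemigroup
  using () renaming (interchange to +-interchange)
open import Algebra.Properties.CommutativeSemigroup ℕ.*-commutativeSemigroup
  using () renaming (x∙yz≈y∙xz to *-x∙yz≈y∙xz)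
open import Data.Nat.Tactic.RingSolver using (solve-∀)
open import Data.Product using (_,_; proj₁; proj₂; ∃-syntax)
open import Data.Product.Properties using (≡-dec)
open import Data.Sum using (_⊎_; inj₁; inj₂; [_,_])
open import Function using (_∘′_; id; Equivalence)
open import Relation.Binary.Definitions using (DecidableEquality; tri<; tri≈; tri>)
open import Relation.Binary.PropositionalEquality using (refl; sym; trans; cong; cong₂; subst; _≢_)
open import Relation.Nullary using (Dec; yes; no; does; ¬_)
open import Relation.Nullary.Decidable using (dec-true; dec-false)
open Relation.Binary.PropositionalEquality.≡-Reasoning

private
  variable
    A B : Set

∑ : List A → (A → ℕ) → ℕ
∑ []       f = 0
∑ (x ∷ xs) f = f x ℕ.+ ∑ xs f

infix 5 ∑
syntax ∑ xs (λ x → e) = ∑[ x ∈ xs ] e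

𝟙 : Bool → ℕ
𝟙 b = if b then 1 else 0

module _ {f g : A → ℕ} where

  ∑-cong : ∀ xs → (∀ x → f x ≡ g x) → ∑ xs f ≡ ∑ xs g
  ∑-cong []       f≗g = refl
  ∑-cong (x ∷ xs) f≗g = cong₂ ℕ._+_ (f≗g x) (∑-cong xs f≗g)

  ∑-+ : ∀ xs → ∑[ x ∈ xs ] (f x ℕ.+ g x) ≡ ∑ xs f ℕ.+ ∑ xs g
  ∑-+ []       = refl
  ∑-+ (x ∷ xs) = trans (cong (f x ℕ.+ g x ℕ.+_) (∑-+ xs)) (+-interchange (f x) (g x) _ _)

∑-distribˡ : ∀ c (f : A → ℕ) xs → c * ∑ xs f ≡ ∑[ x ∈ xs ] (c * f x)
∑-distribˡ c f []       = ℕ.*-zeroʳ c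
∑-distribˡ c f (x ∷ xs) = trans (ℕ.*-distribˡ-+ c (f x) _) (cong (c * f x ℕ.+_) (∑-distribˡ c f xs))

∑-zero : ∀ {f : A → ℕ} xs → (∀ {x} → x ∈ xs → f x ≡ 0) → ∑ xs f ≡ 0
∑-zero []       f≡0 = refl
∑-zero (x ∷ xs) f≡0 = cong₂ ℕ._+_ (f≡0 (here refl)) (∑-zero xs (f≡0 ∘′ there))

∑-swap : ∀ (f : A → B → ℕ) xs ys → ∑[ x ∈ xs ] ∑[ y ∈ ys ] f x y ≡ ∑[ y ∈ ys ] ∑[ x ∈ xs ] f x y
∑-swap f []       ys = sym (∑-zero ys (λ _ → refl))
∑-swap f (x ∷ xs) ys = trans (cong (∑ ys (f x) ℕ.+_) (∑-swap f xs ys)) (sym (∑-+ ys))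

∑-++ : ∀ (f : A → ℕ) xs ys → ∑ (xs ++ ys) f ≡ ∑ xs f ℕ.+ ∑ ys f
∑-++ f []       ys = refl
∑-++ f (x ∷ xs) ys = trans (cong (f x ℕ.+_) (∑-++ f xs ys)) (sym (ℕ.+-assoc (f x) _ _))

∑-cartesianProduct : ∀ (f : A × B → ℕ) xs ys →
  ∑ (cartesianProduct xs ys) f ≡ ∑[ x ∈ xs ] ∑[ y ∈ ys ] f (x , y)
∑-cartesianProduct f []       ys = refl
∑-cartesianProduct f (x ∷ xs) ys = begin
  ∑ (map (x ,_) ys ++ cartesianProduct xs ys) f
    ≡⟨ ∑-++ f (map (x ,_) ys) _ ⟩
  ∑ (map (x ,_) ys) f ℕ.+ ∑ (cartesianProduct xs ys) f
    ≡⟨ cong₂ ℕ._+_ (∑-map ys) (∑-cartesianProduct f xs ys) ⟩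
  (∑[ y ∈ ys ] f (x , y)) ℕ.+ (∑[ x ∈ xs ] ∑[ y ∈ ys ] f (x , y)) ∎
  where
  ∑-map : ∀ ys → ∑ (map (x ,_) ys) f ≡ ∑[ y ∈ ys ] f (x , y)
  ∑-map []       = refl
  ∑-map (y ∷ ys) = cong (f (x , y) ℕ.+_) (∑-map ys)

∑-const : ∀ c (xs : List A) → ∑[ x ∈ xs ] c ≡ length xs * c
∑-const c []       = refl
∑-const c (x ∷ xs) = cong (c ℕ.+_) (∑-const c xs)

∑-single : ∀ {f : A → ℕ} {xs x} → Unique xs → x ∈ xs →
  (∀ {y} → y ∈ xs → y ≢ x → f y ≡ 0) → ∑ xs f ≡ f x
∑-single {f = f} (x∉xs ∷ _) (here refl) f≡0 =
  trans (cong (f _ ℕ.+_) (∑-zero _ λ y∈xs → f≡0 (there y∈xs) λ y≡x → All.lookup x∉xs y∈xs (sym y≡x)))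
        (ℕ.+-identityʳ _)
∑-single {f = f} (y∉xs ∷ u) (there x∈xs) f≡0 =
  cong₂ ℕ._+_ (f≡0 (here refl) (All.lookup y∉xs x∈xs)) (∑-single u x∈xs (f≡0 ∘′ there))

count-∑ : ∀ (P : A → Bool) xs → count P xs ≡ ∑[ x ∈ xs ] 𝟙 (P x)
count-∑ P []       = refl
count-∑ P (x ∷ xs) with P x
... | true  = cong suc (count-∑ P xs)
... | false = count-∑ P xs

𝟙-∧ : ∀ a b → 𝟙 (a ∧ b) ≡ 𝟙 a * 𝟙 b
𝟙-∧ true  b = sym (ℕ.+-identityʳ (𝟙 b))
𝟙-∧ false b = refl

T-allL⁻ : ∀ (P : A → Bool) xs → T (allL P xs) → All (T ∘′ P) xs
T-allL⁻ P []       _   = []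
T-allL⁻ P (x ∷ xs) all = let px , pxs = Equivalence.to T-∧ all in px ∷ T-allL⁻ P xs pxs

T-allL⁺ : ∀ (P : A → Bool) {xs} → All (T ∘′ P) xs → T (allL P xs)
T-allL⁺ P []         = _
T-allL⁺ P (px ∷ pxs) = Equivalence.from T-∧ (px , T-allL⁺ P pxs)

module _ {f : A → A} where

  iter-+ : ∀ m n x → iter f (m ℕ.+ n) x ≡ iter f m (iter f n x)
  iter-+ zero    n x = refl
  iter-+ (suc m) n x = cong f (iter-+ m n x)

  iter-suc : ∀ m x → iter f (suc m) x ≡ iter f m (f x)
  iter-suc m x = trans (cong (λ k → iter f k x) (ℕ.+-comm 1 m)) (iter-+ m 1 x)

  iter-injective : (∀ {x y} → f x ≡ f y → x ≡ y) → ∀ m {x y} → iter f m x ≡ iter f m y → x ≡ y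
  iter-injective f-inj zero    eq = eq
  iter-injective f-inj (suc m) eq = iter-injective f-inj m (f-inj eq)

  iter-*-fixed : ∀ {n x} → iter f n x ≡ x → ∀ k → iter f (k * n) x ≡ x
  iter-*-fixed         fn zero    = refl
  iter-*-fixed {n} {x} fn (suc k) = begin
    iter f (n ℕ.+ k * n) x      ≡⟨ iter-+ n (k * n) x ⟩
    iter f n (iter f (k * n) x) ≡⟨ cong (iter f n) (iter-*-fixed fn k) ⟩
    iter f n x                  ≡⟨ fn ⟩
    x                           ∎

  iter-% : ∀ {n x} .{{_ : NonZero n}} → iter f n x ≡ x → ∀ k → iter f k x ≡ iter f (k % n) x
  iter-% {n} {x} fn k = begin
    iter f k x                                ≡⟨ cong (λ j → iter f j x) (m≡m%n+[m/n]*n k n) ⟩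
    iter f (k % n ℕ.+ (k / n) * n) x          ≡⟨ iter-+ (k % n) _ x ⟩
    iter f (k % n) (iter f ((k / n) * n) x)   ≡⟨ cong (iter f (k % n)) (iter-*-fixed fn (k / n)) ⟩
    iter f (k % n) x                          ∎

  iter-alternating⇒even : ∀ (P : A → Bool) → (∀ x → P (f x) ≡ not (P x)) →
    ∀ k {x} → P (iter f k x) ≡ P x → ∃[ q ] k ≡ q ℕ.+ q
  iter-alternating⇒even P alt zero          _   = 0 , refl
  iter-alternating⇒even P alt (suc zero)    {x} eq = ⊥-elim (not-¬ refl (trans (sym eq) (alt x)))
  iter-alternating⇒even P alt (suc (suc k)) {x} eq
    with q , refl ← iter-alternating⇒even P alt k
        (trans (sym (trans (alt _) (trans (cong not (alt _)) (not-involutive _)))) eq)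
    = suc q , cong suc (sym (ℕ.+-suc q q))

module _ {V : ℕ} where

  toFin : Dart V → Fin (V * 4)
  toFin (v , i) = combine v i

  toFin-injective : ∀ {x y : Dart V} → toFin x ≡ toFin y → x ≡ y
  toFin-injective {v , i} {w , j} eq with refl , refl ← Fin.combine-injective v i w j eq = refl

  toℕ-toFin : ∀ (x : Dart V) → toℕ (toFin x) ≡ key x
  toℕ-toFin (v , i) = trans (Fin.toℕ-combine v i) (cong (ℕ._+ toℕ i) (ℕ.*-comm 4 (toℕ v)))

  key-injective : ∀ {x y : Dart V} → key x ≡ key y → x ≡ y
  key-injective {x} {y} eq =
    toFin-injective (Fin.toℕ-injective (trans (toℕ-toFin x) (trans eq (sym (toℕ-toFin y)))))

  _≟ᴰ_ : DecidableEquality (Dart V)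
  _≟ᴰ_ = ≡-dec Fin._≟_ Fin._≟_

  darts≡cartesianProduct : darts V ≡ cartesianProduct (allFin V) (allFin 4)
  darts≡cartesianProduct = go (allFin V)
    where
    go : ∀ vs → concatMap (λ v → map (v ,_) (allFin 4)) vs ≡ cartesianProduct vs (allFin 4)
    go []       = refl
    go (v ∷ vs) = cong (map (v ,_) (allFin 4) ++_) (go vs)

  darts-unique : Unique (darts V)
  darts-unique = subst Unique (sym darts≡cartesianProduct)
    (Unique.cartesianProduct⁺ (Unique.allFin⁺ V) (Unique.allFin⁺ 4))

  ∈-darts : ∀ (x : Dart V) → x ∈ darts V
  ∈-darts (v , i) = subst ((v , i) ∈_) (sym darts≡cartesianProduct)
    (∈-cartesianProduct⁺ (∈-allFin v) (∈-allFin i))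

  ∑-darts-≟ : ∀ (x : Dart V) → ∑[ d ∈ darts V ] 𝟙 (does (x ≟ᴰ d)) ≡ 1
  ∑-darts-≟ x =
    trans (∑-single darts-unique (∈-darts x) λ _ d≢x → cong 𝟙 (dec-false (x ≟ᴰ _) (d≢x ∘′ sym)))
          (cong 𝟙 (dec-true (x ≟ᴰ x) refl))

  opp-involutive : ∀ (x : Dart V) → opp (opp x) ≡ x
  opp-involutive (v , zero)                   = refl
  opp-involutive (v , suc zero)               = refl
  opp-involutive (v , suc (suc zero))         = refl
  opp-involutive (v , suc (suc (suc zero)))   = refl

  opp-injective : ∀ {x y : Dart V} → opp x ≡ opp y → x ≡ y
  opp-injective {x} {y} eq = trans (sym (opp-involutive x)) (trans (cong opp eq) (opp-involutive y))

  opp-nonFixed : ∀ (x : Dart V) → opp x ≢ x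
  opp-nonFixed (v , zero)                 ()
  opp-nonFixed (v , suc zero)             ()
  opp-nonFixed (v , suc (suc zero))       ()
  opp-nonFixed (v , suc (suc (suc zero))) ()

  ∑-darts-opp : ∀ {c} (f : Dart V → ℕ) → (∀ d → f d ℕ.+ f (opp d) ≡ c) → ∑ (darts V) f ≡ V * (c ℕ.+ c)
  ∑-darts-opp {c} f pair = begin
    ∑ (darts V) f                                 ≡⟨ cong (λ ds → ∑ ds f) darts≡cartesianProduct ⟩
    ∑ (cartesianProduct (allFin V) (allFin 4)) f  ≡⟨ ∑-cartesianProduct f (allFin V) (allFin 4) ⟩
    ∑[ v ∈ allFin V ] ∑[ i ∈ allFin 4 ] f (v , i) ≡⟨ ∑-cong (allFin V) atVertex ⟩
    ∑[ v ∈ allFin V ] (c ℕ.+ c)                   ≡⟨ ∑-const (c ℕ.+ c) (allFin V) ⟩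
    length (allFin V) * (c ℕ.+ c)                 ≡⟨ cong (_* (c ℕ.+ c)) (length-tabulate {n = V} id) ⟩
    V * (c ℕ.+ c)                                 ∎
    where
    atVertex : ∀ v → ∑[ i ∈ allFin 4 ] f (v , i) ≡ c ℕ.+ c
    atVertex v =
      trans (regroup (f (v , zero)) (f (v , suc zero)) (f (v , suc (suc zero))) (f (v , suc (suc (suc zero)))))
            (cong₂ ℕ._+_ (pair (v , zero)) (pair (v , suc zero)))
      where
      regroup : ∀ a b a′ b′ → a ℕ.+ (b ℕ.+ (a′ ℕ.+ (b′ ℕ.+ 0))) ≡ (a ℕ.+ a′) ℕ.+ (b ℕ.+ b′)
      regroup = solve-∀

module Orbit {V : ℕ} (f : Dart V → Dart V) (f-injective : ∀ {x y} → f x ≡ f y → x ≡ y) where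

  iter-cancel : ∀ i d {x} → iter f (i ℕ.+ d) x ≡ iter f i x → iter f d x ≡ x
  iter-cancel i d {x} eq = iter-injective f-injective i (trans (sym (iter-+ i d x)) eq)

  period-exists : ∀ h → ∃[ d ] 0 < d × d ℕ.≤ N V × iter f d h ≡ h
  period-exists h with i , j , i<j , eq ← Fin.pigeonhole (ℕ.n<1+n (V * 4)) (λ k → toFin (iter f (toℕ k) h)) =
    toℕ j ∸ toℕ i , ℕ.m<n⇒0<n∸m i<j , d≤N ,
    iter-cancel (toℕ i) _ (trans (cong (λ k → iter f k h) (ℕ.m+[n∸m]≡n (ℕ.<⇒≤ i<j)))
                                 (sym (toFin-injective eq)))
    where
    d≤N : toℕ j ∸ toℕ i ℕ.≤ N V
    d≤N = ℕ.≤-trans (ℕ.m∸n≤m (toℕ j) (toℕ i))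
                    (subst (toℕ j ℕ.≤_) (ℕ.*-comm V 4) (ℕ.≤-pred (Fin.toℕ<n j)))

  firstReturn-applyUpTo : ∀ h g n {i} → i < n → iter f (g i) h ≡ h →
    ∃[ r ] r < n × firstReturn f h (applyUpTo g n) ≡ g r × iter f (g r) h ≡ h
           × (∀ {j} → j < r → iter f (g j) h ≢ h)
  firstReturn-applyUpTo h g (suc n) {i} i<n ret with key (iter f (g 0) h) ≡ᵇ key h in test
  ... | true  = 0 , ℕ.z<s , refl , key-injective (ℕ.≡ᵇ⇒≡ _ _ (subst T (sym test) _)) , λ ()
  ... | false with i
  ...   | zero  = ⊥-elim (subst T test (ℕ.≡⇒≡ᵇ _ _ (cong key ret)))
  ...   | suc _
        with r , r<n , fr , ret′ , first ← firstReturn-applyUpTo h (g ∘′ suc) n (ℕ.≤-pred i<n) ret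
        = suc r , ℕ.s<s r<n , fr , ret′ , earlier
    where
    earlier : ∀ {j} → j < suc r → iter f (g j) h ≢ h
    earlier {zero}  _         ret₀ = subst T test (ℕ.≡⇒≡ᵇ _ _ (cong key ret₀))
    earlier {suc j} (ℕ.s≤s j<r) = first j<r

  orbitLen-spec : ∀ h → ∃[ r ] r < N V × orbitLen f h ≡ suc r × iter f (suc r) h ≡ h
                                × (∀ {j} → j < r → iter f (suc j) h ≢ h)
  orbitLen-spec h with suc _ , _ , d≤N , ret ← period-exists h
    with r , r<N , fr , ret′ , first ← firstReturn-applyUpTo h suc (N V) d≤N ret
    = r , r<N , trans (cong (firstReturn f h) (map-upTo suc (N V))) fr , ret′ , first

  orbitLen≤N : ∀ h → orbitLen f h ℕ.≤ N V
  orbitLen≤N h with _ , r<N , L≡ , _ ← orbitLen-spec h rewrite L≡ = r<N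

  instance
    orbitLen-nonZero : ∀ {h} → NonZero (orbitLen f h)
    orbitLen-nonZero {h} with _ , _ , L≡ , _ ← orbitLen-spec h rewrite L≡ = _

  iter-orbitLen : ∀ h → iter f (orbitLen f h) h ≡ h
  iter-orbitLen h with _ , _ , L≡ , ret , _ ← orbitLen-spec h rewrite L≡ = ret

  iter-orbitLen-minimal : ∀ {h j} → 0 < j → j < orbitLen f h → iter f j h ≢ h
  iter-orbitLen-minimal {h} {suc j} _ j<L with _ , _ , L≡ , _ , first ← orbitLen-spec h =
    first (ℕ.s<s⁻¹ (subst (suc j <_) L≡ j<L))

  iter-distinct-below-orbitLen : ∀ {h a b} → a < b → b < orbitLen f h → iter f b h ≢ iter f a h
  iter-distinct-below-orbitLen {h} {a} {b} a<b b<L eq =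
    iter-orbitLen-minimal (ℕ.m<n⇒0<n∸m a<b) (ℕ.≤-<-trans (ℕ.m∸n≤m b a) b<L)
      (iter-cancel a (b ∸ a) (trans (cong (λ k → iter f k h) (ℕ.m+[n∸m]≡n (ℕ.<⇒≤ a<b))) eq))

  iter-injective-below-orbitLen : ∀ {h i j} → i < orbitLen f h → j < orbitLen f h →
                                  iter f i h ≡ iter f j h → i ≡ j
  iter-injective-below-orbitLen {h} {i} {j} i<L j<L eq with ℕ.<-cmp i j
  ... | tri≈ _ i≡j _ = i≡j
  ... | tri< i<j _ _ = ⊥-elim (iter-distinct-below-orbitLen i<j j<L (sym eq))
  ... | tri> _ _ j<i = ⊥-elim (iter-distinct-below-orbitLen j<i i<L eq)

  OnOrbit : Dart V → Dart V → Set
  OnOrbit h d = ∃[ k ] iter f k h ≡ d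

  OnOrbit-below : ∀ {h d} → OnOrbit h d → ∃[ k ] k < orbitLen f h × iter f k h ≡ d
  OnOrbit-below {h} (k , eq) = k % orbitLen f h , m%n<n k _ , trans (sym (iter-% (iter-orbitLen h) k)) eq

  OnOrbit-trans : ∀ {a b c} → OnOrbit a b → OnOrbit b c → OnOrbit a c
  OnOrbit-trans {a} (k , refl) (l , refl) = l ℕ.+ k , iter-+ l k a

  OnOrbit-sym : ∀ {a b} → OnOrbit a b → OnOrbit b a
  OnOrbit-sym {a} o with k , k<L , refl ← OnOrbit-below o = orbitLen f a ∸ k , (begin
    iter f (orbitLen f a ∸ k) (iter f k a) ≡⟨ iter-+ (orbitLen f a ∸ k) k a ⟨
    iter f (orbitLen f a ∸ k ℕ.+ k) a     ≡⟨ cong (λ n → iter f n a) (ℕ.m∸n+n≡m (ℕ.<⇒≤ k<L)) ⟩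
    iter f (orbitLen f a) a               ≡⟨ iter-orbitLen a ⟩
    a                                     ∎)

  OnOrbit? : ∀ h d → Dec (OnOrbit h d)
  OnOrbit? h d with any? (λ k → iter f k h ≟ᴰ d) (upTo (orbitLen f h))
  ... | yes found = yes (satisfied found)
  ... | no  none  = no λ o → let k , k<L , eq = OnOrbit-below o in none (lose (∈-upTo⁺ k<L) eq)

  visits : Dart V → Dart V → ℕ
  visits h d = ∑[ k ∈ upTo (orbitLen f h) ] 𝟙 (does (iter f k h ≟ᴰ d))

  visits-onOrbit : ∀ {h d} → OnOrbit h d → visits h d ≡ 1
  visits-onOrbit {h} {d} o with k , k<L , eq ← OnOrbit-below o =
    trans (∑-single (Unique.upTo⁺ _) (∈-upTo⁺ k<L) elsewhere) (cong 𝟙 (dec-true (_ ≟ᴰ d) eq))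
    where
    elsewhere : ∀ {j} → j ∈ upTo (orbitLen f h) → j ≢ k → 𝟙 (does (iter f j h ≟ᴰ d)) ≡ 0
    elsewhere j∈ j≢k = cong 𝟙 (dec-false (_ ≟ᴰ d) λ eq′ →
      j≢k (iter-injective-below-orbitLen (∈-upTo⁻ j∈) k<L (trans eq′ (sym eq))))

  visits-offOrbit : ∀ {h d} → ¬ OnOrbit h d → visits h d ≡ 0
  visits-offOrbit {h} {d} ¬o =
    ∑-zero (upTo (orbitLen f h)) λ {k} _ → cong 𝟙 (dec-false (_ ≟ᴰ d) λ eq → ¬o (k , eq))

  ∑-visits : ∀ h → ∑[ d ∈ darts V ] visits h d ≡ orbitLen f h
  ∑-visits h = begin
    ∑[ d ∈ darts V ] visits h d
      ≡⟨ ∑-swap (λ d k → 𝟙 (does (iter f k h ≟ᴰ d))) (darts V) (upTo L) ⟩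
    ∑[ k ∈ upTo L ] ∑[ d ∈ darts V ] 𝟙 (does (iter f k h ≟ᴰ d))
      ≡⟨ ∑-cong (upTo L) (λ k → ∑-darts-≟ (iter f k h)) ⟩
    ∑[ k ∈ upTo L ] 1
      ≡⟨ ∑-const 1 (upTo L) ⟩
    length (upTo L) * 1
      ≡⟨ cong (_* 1) (length-upTo L) ⟩
    L * 1
      ≡⟨ ℕ.*-identityʳ L ⟩
    L ∎
    where L = orbitLen f h

module StraightFaces {V : ℕ} (G : MOGraph V) where
  open MOGraph G

  out-opp : ∀ x → out (opp x) ≡ out x
  out-opp x = trans (out-alt (σ x)) (trans (cong not (out-alt x)) (not-involutive (out x)))

  out-τ : ∀ x → out (τ G x) ≡ not (out x)
  out-τ x = trans (out-edge (opp x)) (cong not (out-opp x))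

  α-injective : ∀ {x y} → α x ≡ α y → x ≡ y
  α-injective {x} {y} eq = trans (sym (α-invol x)) (trans (cong α eq) (α-invol y))

  τ-injective : ∀ {x y} → τ G x ≡ τ G y → x ≡ y
  τ-injective = opp-injective ∘′ α-injective

  τ-opp-τ : ∀ x → τ G (opp (τ G x)) ≡ opp x
  τ-opp-τ x = trans (cong α (opp-involutive (α (opp x)))) (α-invol (opp x))

  iter-τ-opp : ∀ m x → iter (τ G) m (opp (iter (τ G) m x)) ≡ opp x
  iter-τ-opp zero    x = refl
  iter-τ-opp (suc m) x = begin
    iter (τ G) (suc m) (opp (τ G (iter (τ G) m x))) ≡⟨ iter-suc m _ ⟩
    iter (τ G) m (τ G (opp (τ G (iter (τ G) m x)))) ≡⟨ cong (iter (τ G) m) (τ-opp-τ (iter (τ G) m x)) ⟩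
    iter (τ G) m (opp (iter (τ G) m x))             ≡⟨ iter-τ-opp m x ⟩
    opp x                                           ∎

  open Orbit (τ G) τ-injective public

  OnOrbit-opp : ∀ {a b} → OnOrbit a b → OnOrbit (opp b) (opp a)
  OnOrbit-opp {a} (k , refl) = k , iter-τ-opp k a

  -- τ flips the orientation status and opp keeps it, so τᵏ x = opp x forces k = 2q;
  -- then y = τ^q x satisfies τ^q y = opp x = τ^q (opp y), whence y = opp y.
  ¬OnOrbit-opp : ∀ x → ¬ OnOrbit x (opp x)
  ¬OnOrbit-opp x (k , eq)
    with q , refl ← iter-alternating⇒even out out-τ k (trans (cong out eq) (out-opp x)) =
    opp-nonFixed y (sym (iter-injective τ-injective q (begin
      iter (τ G) q y             ≡⟨ iter-+ q q x ⟨
      iter (τ G) (q ℕ.+ q) x     ≡⟨ eq ⟩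
      opp x                      ≡⟨ iter-τ-opp q x ⟨
      iter (τ G) q (opp y)       ∎)))
    where y = iter (τ G) q x

  orbitLen-even : ∀ h → ∃[ q ] orbitLen (τ G) h ≡ q ℕ.+ q
  orbitLen-even h = iter-alternating⇒even out out-τ _ (cong out (iter-orbitLen h))

  SameFace : Dart V → Dart V → Set
  SameFace h d = OnOrbit h d ⊎ OnOrbit h (opp d)

  SameFace-sym : ∀ {a b} → SameFace a b → SameFace b a
  SameFace-sym         (inj₁ o) = inj₁ (OnOrbit-sym o)
  SameFace-sym {a} {b} (inj₂ o) = inj₂ (subst (λ x → OnOrbit x (opp a)) (opp-involutive b) (OnOrbit-opp o))

  SameFace-trans : ∀ {a b c} → SameFace a b → SameFace b c → SameFace a c
  SameFace-trans     (inj₁ o) (inj₁ o′) = inj₁ (OnOrbit-trans o o′)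
  SameFace-trans     (inj₁ o) (inj₂ o′) = inj₂ (OnOrbit-trans o o′)
  SameFace-trans     (inj₂ o) (inj₁ o′) = inj₂ (OnOrbit-trans o (OnOrbit-sym (OnOrbit-opp o′)))
  SameFace-trans {c = c} (inj₂ o) (inj₂ o′) =
    inj₁ (subst (OnOrbit _) (opp-involutive c) (OnOrbit-trans o (OnOrbit-sym (OnOrbit-opp o′))))

  isRep : Dart V → Bool
  isRep = isStraightRep G

  isRep⇒minimal : ∀ {h d} → T (isRep h) → SameFace h d → key h ℕ.≤ key d
  isRep⇒minimal {h} {d} rep face = minimalAt face
    where
    atIterate : ∀ {k} → k < orbitLen (τ G) h →
      T (key h ≤ᵇ key (iter (τ G) k h)) × T (key h ≤ᵇ key (opp (iter (τ G) k h)))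
    atIterate k<L = Equivalence.to T-∧
      (All.lookup (T-allL⁻ _ (upTo (N V)) rep) (∈-upTo⁺ (ℕ.<-≤-trans k<L (orbitLen≤N h))))
    minimalAt : SameFace h d → key h ℕ.≤ key d
    minimalAt (inj₁ o) with k , k<L , refl ← OnOrbit-below o = ℕ.≤ᵇ⇒≤ _ _ (proj₁ (atIterate k<L))
    minimalAt (inj₂ o) with k , k<L , eq ← OnOrbit-below o =
      subst (λ x → key h ℕ.≤ key x) (trans (cong opp eq) (opp-involutive d))
            (ℕ.≤ᵇ⇒≤ _ _ (proj₂ (atIterate k<L)))

  minimal⇒isRep : ∀ {h} → (∀ {d} → SameFace h d → key h ℕ.≤ key d) → T (isRep h)
  minimal⇒isRep {h} minimal = T-allL⁺ _ {upTo (N V)} (All.tabulate λ {k} _ → Equivalence.from T-∧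
    (ℕ.≤⇒≤ᵇ (minimal (inj₁ (k , refl))) , ℕ.≤⇒≤ᵇ (minimal (inj₂ (k , sym (opp-involutive _))))))

  faceDarts : Dart V → List (Dart V)
  faceDarts d = map (λ k → iter (τ G) k d) (upTo (N V)) ++ map (λ k → opp (iter (τ G) k d)) (upTo (N V))

  ∈-faceDarts⁻ : ∀ {d x} → x ∈ faceDarts d → SameFace d x
  ∈-faceDarts⁻ {d} x∈ with ∈-++⁻ (map (λ k → iter (τ G) k d) (upTo (N V))) x∈
  ... | inj₁ x∈ˡ with k , _ , refl ← ∈-map⁻ (λ k → iter (τ G) k d) x∈ˡ = inj₁ (k , refl)
  ... | inj₂ x∈ʳ with k , _ , refl ← ∈-map⁻ (λ k → opp (iter (τ G) k d)) x∈ʳ =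
    inj₂ (k , sym (opp-involutive _))

  ∈-faceDarts⁺ : ∀ {d x} → SameFace d x → x ∈ faceDarts d
  ∈-faceDarts⁺ {d} (inj₁ o) with k , k<L , refl ← OnOrbit-below o =
    ∈-++⁺ˡ (∈-map⁺ (λ k → iter (τ G) k d) (∈-upTo⁺ (ℕ.<-≤-trans k<L (orbitLen≤N d))))
  ∈-faceDarts⁺ {d} {x} (inj₂ o) with k , k<L , eq ← OnOrbit-below o =
    subst (_∈ faceDarts d) (trans (cong opp eq) (opp-involutive x))
      (∈-++⁺ʳ _ (∈-map⁺ (λ k → opp (iter (τ G) k d)) (∈-upTo⁺ (ℕ.<-≤-trans k<L (orbitLen≤N d)))))

  faceRep : Dart V → Dart V
  faceRep d = argmin key d (faceDarts d)

  SameFace-faceRep : ∀ d → SameFace d (faceRep d)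
  SameFace-faceRep d = argmin-all key (inj₁ (0 , refl)) (All.tabulate ∈-faceDarts⁻)

  faceRep-minimal : ∀ {d x} → SameFace d x → key (faceRep d) ℕ.≤ key x
  faceRep-minimal {d} face = All.lookup (f[argmin]≤f[xs] d (faceDarts d)) (∈-faceDarts⁺ face)

  faceRep-isRep : ∀ d → T (isRep (faceRep d))
  faceRep-isRep d = minimal⇒isRep λ face → faceRep-minimal (SameFace-trans (SameFace-faceRep d) face)

  isRep⇒faceRep : ∀ {h d} → T (isRep h) → SameFace h d → h ≡ faceRep d
  isRep⇒faceRep {h} {d} rep face = key-injective (ℕ.≤-antisym
    (isRep⇒minimal rep (SameFace-trans face (SameFace-faceRep d)))
    (faceRep-minimal (SameFace-sym face)))

  isRep-visits-face : ∀ d h → 𝟙 (isRep h) * (visits h d ℕ.+ visits h (opp d)) ≡ 𝟙 (does (faceRep d ≟ᴰ h))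
  isRep-visits-face d h with isRep h in isRep-h
  ... | false = cong 𝟙 (sym (dec-false (faceRep d ≟ᴰ h) λ eq →
                  subst T (trans (cong isRep eq) isRep-h) (faceRep-isRep d)))
  ... | true with OnOrbit? h d | OnOrbit? h (opp d)
  ...   | yes o | yes o′ = ⊥-elim (¬OnOrbit-opp d (OnOrbit-trans (OnOrbit-sym o) o′))
  ...   | yes o | no ¬o′ = trans (cong₂ (λ a b → 1 * (a ℕ.+ b)) (visits-onOrbit o) (visits-offOrbit ¬o′))
                                 (cong 𝟙 (sym (dec-true (faceRep d ≟ᴰ h) (sym (isRep⇒faceRep rep (inj₁ o))))))
    where rep = subst T (sym isRep-h) _
  ...   | no ¬o | yes o′ = trans (cong₂ (λ a b → 1 * (a ℕ.+ b)) (visits-offOrbit ¬o) (visits-onOrbit o′))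
                                 (cong 𝟙 (sym (dec-true (faceRep d ≟ᴰ h) (sym (isRep⇒faceRep rep (inj₂ o′))))))
    where rep = subst T (sym isRep-h) _
  ...   | no ¬o | no ¬o′ = trans (cong₂ (λ a b → 1 * (a ℕ.+ b)) (visits-offOrbit ¬o) (visits-offOrbit ¬o′))
                                 (cong 𝟙 (sym (dec-false (faceRep d ≟ᴰ h) λ eq →
                                   [ ¬o , ¬o′ ] (SameFace-sym (subst (SameFace d) eq (SameFace-faceRep d))))))

  ∑-isRep-orbitLen : ∑[ h ∈ darts V ] 𝟙 (isRep h) * orbitLen (τ G) h ≡ V * 2
  ∑-isRep-orbitLen = begin
    ∑[ h ∈ darts V ] 𝟙 (isRep h) * orbitLen (τ G) h
      ≡⟨ ∑-cong (darts V) (λ h → trans (cong (𝟙 (isRep h) *_) (sym (∑-visits h)))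
                                       (∑-distribˡ (𝟙 (isRep h)) (visits h) (darts V))) ⟩
    ∑[ h ∈ darts V ] ∑[ d ∈ darts V ] 𝟙 (isRep h) * visits h d
      ≡⟨ ∑-swap (λ h d → 𝟙 (isRep h) * visits h d) (darts V) (darts V) ⟩
    ∑[ d ∈ darts V ] covered d
      ≡⟨ ∑-darts-opp covered covered-opp ⟩
    V * 2 ∎
    where
    covered : Dart V → ℕ
    covered d = ∑[ h ∈ darts V ] 𝟙 (isRep h) * visits h d

    covered-opp : ∀ d → covered d ℕ.+ covered (opp d) ≡ 1
    covered-opp d = begin
      covered d ℕ.+ covered (opp d)
        ≡⟨ ∑-+ (darts V) ⟨
      ∑[ h ∈ darts V ] (𝟙 (isRep h) * visits h d ℕ.+ 𝟙 (isRep h) * visits h (opp d))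
        ≡⟨ ∑-cong (darts V) (λ h → sym (ℕ.*-distribˡ-+ (𝟙 (isRep h)) _ _)) ⟩
      ∑[ h ∈ darts V ] 𝟙 (isRep h) * (visits h d ℕ.+ visits h (opp d))
        ≡⟨ ∑-cong (darts V) (isRep-visits-face d) ⟩
      ∑[ h ∈ darts V ] 𝟙 (does (faceRep d ≟ᴰ h))
        ≡⟨ ∑-darts-≟ (faceRep d) ⟩
      1 ∎

  halfLengths : List ℕ
  halfLengths = map suc (upTo (N V))

  Fsp≡∑ : ∀ p → Fsp G p ≡ ∑[ h ∈ darts V ] 𝟙 (isRep h) * 𝟙 (orbitLen (τ G) h ≡ᵇ 2 * p)
  Fsp≡∑ p = trans (count-∑ _ (darts V)) (∑-cong (darts V) (λ h → 𝟙-∧ (isRep h) _))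

  ∑-halfLengths-select : ∀ (F : ℕ → ℕ) {q} → 0 < q → q ℕ.≤ N V →
    ∑[ p ∈ halfLengths ] F p * 𝟙 (q ℕ.+ q ≡ᵇ 2 * p) ≡ F q
  ∑-halfLengths-select F {suc i} _ q≤N = begin
    ∑[ p ∈ halfLengths ] F p * 𝟙 (q ℕ.+ q ≡ᵇ 2 * p)
      ≡⟨ ∑-single (Unique.map⁺ ℕ.suc-injective (Unique.upTo⁺ (N V))) (∈-map⁺ suc (∈-upTo⁺ q≤N))
                  elsewhere ⟩
    F q * 𝟙 (q ℕ.+ q ≡ᵇ 2 * q)
      ≡⟨ cong (λ b → F q * 𝟙 b) (dec-true (q ℕ.+ q ℕ.≟ 2 * q) (cong (q ℕ.+_) (sym (ℕ.+-identityʳ q)))) ⟩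
    F q * 1
      ≡⟨ ℕ.*-identityʳ (F q) ⟩
    F q ∎
    where
    q = suc i
    elsewhere : ∀ {p} → p ∈ halfLengths → p ≢ q → F p * 𝟙 (q ℕ.+ q ≡ᵇ 2 * p) ≡ 0
    elsewhere {p} _ p≢q = trans (cong (λ b → F p * 𝟙 b) (dec-false (q ℕ.+ q ℕ.≟ 2 * p) λ eq →
      p≢q (ℕ.*-cancelˡ-≡ p q 2 (trans (sym eq) (cong (q ℕ.+_) (sym (ℕ.+-identityʳ q)))))))
      (ℕ.*-zeroʳ (F p))

  2*⌊orbitLen/2⌋≡orbitLen : ∀ h → 2 * ⌊ orbitLen (τ G) h /2⌋ ≡ orbitLen (τ G) h
  2*⌊orbitLen/2⌋≡orbitLen h with q , L≡ ← orbitLen-even h = begin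
    2 * ⌊ orbitLen (τ G) h /2⌋ ≡⟨ cong (λ n → 2 * ⌊ n /2⌋) L≡ ⟩
    2 * ⌊ q ℕ.+ q /2⌋          ≡⟨ cong (2 *_) (ℕ.n≡⌊n+n/2⌋ q) ⟨
    2 * q                      ≡⟨ cong (q ℕ.+_) (ℕ.+-identityʳ q) ⟩
    q ℕ.+ q                    ≡⟨ L≡ ⟨
    orbitLen (τ G) h           ∎

  ∑-halfLengths-orbitLen : ∀ (F : ℕ → ℕ) h →
    ∑[ p ∈ halfLengths ] F p * 𝟙 (orbitLen (τ G) h ≡ᵇ 2 * p) ≡ F ⌊ orbitLen (τ G) h /2⌋
  ∑-halfLengths-orbitLen F h with q , L≡ ← orbitLen-even h = begin
    ∑[ p ∈ halfLengths ] F p * 𝟙 (orbitLen (τ G) h ≡ᵇ 2 * p)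
      ≡⟨ cong (λ n → ∑[ p ∈ halfLengths ] F p * 𝟙 (n ≡ᵇ 2 * p)) L≡ ⟩
    ∑[ p ∈ halfLengths ] F p * 𝟙 (q ℕ.+ q ≡ᵇ 2 * p)
      ≡⟨ ∑-halfLengths-select F 0<q q≤N ⟩
    F q
      ≡⟨ cong F (ℕ.n≡⌊n+n/2⌋ q) ⟩
    F ⌊ q ℕ.+ q /2⌋
      ≡⟨ cong (λ n → F ⌊ n /2⌋) L≡ ⟨
    F ⌊ orbitLen (τ G) h /2⌋ ∎
    where
    0<q : 0 < q
    0<q = ℕ.n≢0⇒n>0 λ { refl → ℕ.≢-nonZero⁻¹ (orbitLen (τ G) h) L≡ }
    q≤N : q ℕ.≤ N V
    q≤N = ℕ.≤-trans (ℕ.m≤m+n q q) (subst (ℕ._≤ N V) L≡ (orbitLen≤N h))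

  ∑-weighted-Fsp : ∀ (F : ℕ → ℕ) →
    ∑[ p ∈ halfLengths ] F p * Fsp G p ≡ ∑[ h ∈ darts V ] 𝟙 (isRep h) * F ⌊ orbitLen (τ G) h /2⌋
  ∑-weighted-Fsp F = begin
    ∑[ p ∈ halfLengths ] F p * Fsp G p
      ≡⟨ ∑-cong halfLengths (λ p → trans (cong (F p *_) (Fsp≡∑ p)) (∑-distribˡ (F p) _ (darts V))) ⟩
    ∑[ p ∈ halfLengths ] ∑[ h ∈ darts V ] F p * (𝟙 (isRep h) * sized h p)
      ≡⟨ ∑-swap _ halfLengths (darts V) ⟩
    ∑[ h ∈ darts V ] ∑[ p ∈ halfLengths ] F p * (𝟙 (isRep h) * sized h p)
      ≡⟨ ∑-cong (darts V) (λ h → ∑-cong halfLengths λ p → *-x∙yz≈y∙xz (F p) (𝟙 (isRep h)) (sized h p)) ⟩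
    ∑[ h ∈ darts V ] ∑[ p ∈ halfLengths ] 𝟙 (isRep h) * (F p * sized h p)
      ≡⟨ ∑-cong (darts V) (λ h → sym (∑-distribˡ (𝟙 (isRep h)) _ halfLengths)) ⟩
    ∑[ h ∈ darts V ] 𝟙 (isRep h) * (∑[ p ∈ halfLengths ] F p * sized h p)
      ≡⟨ ∑-cong (darts V) (λ h → cong (𝟙 (isRep h) *_) (∑-halfLengths-orbitLen F h)) ⟩
    ∑[ h ∈ darts V ] 𝟙 (isRep h) * F ⌊ orbitLen (τ G) h /2⌋ ∎
    where
    sized : Dart V → ℕ → ℕ
    sized h p = 𝟙 (orbitLen (τ G) h ≡ᵇ 2 * p)

  ∑-p*Fsp≡V : ∑[ p ∈ halfLengths ] p * Fsp G p ≡ V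
  ∑-p*Fsp≡V = ℕ.*-cancelˡ-≡ _ V 2 (begin
    2 * (∑[ p ∈ halfLengths ] p * Fsp G p)
      ≡⟨ cong (2 *_) (∑-weighted-Fsp id) ⟩
    2 * (∑[ h ∈ darts V ] 𝟙 (isRep h) * ⌊ orbitLen (τ G) h /2⌋)
      ≡⟨ ∑-distribˡ 2 _ (darts V) ⟩
    ∑[ h ∈ darts V ] 2 * (𝟙 (isRep h) * ⌊ orbitLen (τ G) h /2⌋)
      ≡⟨ ∑-cong (darts V) (λ h → trans (*-x∙yz≈y∙xz 2 (𝟙 (isRep h)) _)
                                       (cong (𝟙 (isRep h) *_) (2*⌊orbitLen/2⌋≡orbitLen h))) ⟩
    ∑[ h ∈ darts V ] 𝟙 (isRep h) * orbitLen (τ G) h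
      ≡⟨ ∑-isRep-orbitLen ⟩
    V * 2
      ≡⟨ ℕ.*-comm V 2 ⟩
    2 * V ∎)

  ∑-Fsp≡Fs : ∑[ p ∈ halfLengths ] Fsp G p ≡ Fs G
  ∑-Fsp≡Fs = begin
    ∑[ p ∈ halfLengths ] Fsp G p     ≡⟨ ∑-cong halfLengths (λ p → sym (ℕ.*-identityˡ (Fsp G p))) ⟩
    ∑[ p ∈ halfLengths ] 1 * Fsp G p ≡⟨ ∑-weighted-Fsp (λ _ → 1) ⟩
    ∑[ h ∈ darts V ] 𝟙 (isRep h) * 1 ≡⟨ ∑-cong (darts V) (λ h → ℕ.*-identityʳ (𝟙 (isRep h))) ⟩
    ∑[ h ∈ darts V ] 𝟙 (isRep h)     ≡⟨ count-∑ isRep (darts V) ⟨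
    Fs G                             ∎

foldr-Λ : ∀ (F : ℕ → ℕ) xs →
  foldr (λ p acc → (+ p - + 2) ℤ.* + F p + acc) (+ 0) xs ≡ + (∑[ p ∈ xs ] p * F p) - + (2 * ∑ xs F)
foldr-Λ F []       = refl
foldr-Λ F (x ∷ xs) = begin
  (+ x - + 2) ℤ.* + F x + foldr _ (+ 0) xs
    ≡⟨ cong (λ z → (+ x - + 2) ℤ.* + F x + z) (trans (foldr-Λ F xs) (cong (+ S₁ -_) (ℤ.pos-* 2 S₀))) ⟩
  (+ x - + 2) ℤ.* + F x + (+ S₁ - + 2 ℤ.* + S₀)
    ≡⟨ regroup (+ x) (+ F x) (+ S₁) (+ S₀) ⟩
  (+ x ℤ.* + F x + + S₁) - + 2 ℤ.* (+ F x + + S₀)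
    ≡⟨ cong₂ _-_ (trans (ℤ.pos-+ (x * F x) S₁) (cong (_+ + S₁) (ℤ.pos-* x (F x))))
                 (trans (ℤ.pos-* 2 (F x ℕ.+ S₀)) (cong (+ 2 ℤ.*_) (ℤ.pos-+ (F x) S₀))) ⟨
  + (x * F x ℕ.+ S₁) - + (2 * (F x ℕ.+ S₀)) ∎
  where
  S₁ = ∑[ p ∈ xs ] p * F p
  S₀ = ∑ xs F
  regroup : ∀ p f s₁ s₀ → (p - + 2) ℤ.* f + (s₁ - + 2 ℤ.* s₀) ≡ (p ℤ.* f + s₁) - + 2 ℤ.* (f + s₀)
  regroup = ℤ.solve-∀

Λ≡V-2Fs+2 : ∀ {V} (G : MOGraph V) → Λ G ≡ + V - + (2 * Fs G) + + 2
Λ≡V-2Fs+2 G = cong (_+ + 2) (trans (foldr-Λ (Fsp G) halfLengths)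
                                   (cong₂ (λ s₁ s₀ → + s₁ - + (2 * s₀)) ∑-p*Fsp≡V ∑-Fsp≡Fs))
  where open StraightFaces G

twoδ-4g≡V-2Fs+2 : ∀ {V} (G : MOGraph V) {g} → IsGenus G g → twoδ G - + (4 * g) ≡ + V - + (2 * Fs G) + + 2
twoδ-4g≡V-2Fs+2 {v} G {g} euler = begin
  + 6 + + (3 * v) - + (2 * (fm ℕ.+ fs)) - + (4 * g)
    ≡⟨ cong₂ _-_ (cong₂ (λ a b → + 6 + a - b) (ℤ.pos-* 3 v)
                        (trans (ℤ.pos-* 2 (fm ℕ.+ fs)) (cong (λ z → + 2 ℤ.* z) (ℤ.pos-+ fm fs))))
                 (ℤ.pos-* 4 g) ⟩
  + 6 + + 3 ℤ.* + v - + 2 ℤ.* (+ fm + + fs) - + 4 ℤ.* + g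
    ≡⟨ split (+ v) (+ fm) (+ fs) (+ g) ⟩
  + v - + 2 ℤ.* + fs + + 2 + + 2 ℤ.* ((+ 2 + + 2 ℤ.* + v) - (+ v + + fm + + 2 ℤ.* + g))
    ≡⟨ cong (λ z → + v - + 2 ℤ.* + fs + + 2 + + 2 ℤ.* ((+ 2 + + 2 ℤ.* + v) - z)) eulerℤ ⟩
  + v - + 2 ℤ.* + fs + + 2 + + 2 ℤ.* ((+ 2 + + 2 ℤ.* + v) - (+ 2 + + 2 ℤ.* + v))
    ≡⟨ cancel (+ v - + 2 ℤ.* + fs + + 2) (+ 2 + + 2 ℤ.* + v) ⟩
  + v - + 2 ℤ.* + fs + + 2
    ≡⟨ cong (λ z → + v - z + + 2) (ℤ.pos-* 2 fs) ⟨
  + v - + (2 * fs) + + 2 ∎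
  where
  fm = Fmap G
  fs = Fs G
  -- Euler's formula enters as the vanishing of (2 + 2V) − (V + F_map + 2g).
  eulerℤ : + v + + fm + + 2 ℤ.* + g ≡ + 2 + + 2 ℤ.* + v
  eulerℤ = begin
    + v + + fm + + 2 ℤ.* + g ≡⟨ cong₂ _+_ (ℤ.pos-+ v fm) (ℤ.pos-* 2 g) ⟨
    + (v ℕ.+ fm) + + (2 * g) ≡⟨ ℤ.pos-+ (v ℕ.+ fm) (2 * g) ⟨
    + (v ℕ.+ fm ℕ.+ 2 * g)   ≡⟨ cong +_ euler ⟩
    + (2 ℕ.+ 2 * v)          ≡⟨ trans (ℤ.pos-+ 2 (2 * v)) (cong (λ z → + 2 + z) (ℤ.pos-* 2 v)) ⟩
    + 2 + + 2 ℤ.* + v        ∎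
  split : ∀ v fm fs g → + 6 + + 3 ℤ.* v - + 2 ℤ.* (fm + fs) - + 4 ℤ.* g
                      ≡ v - + 2 ℤ.* fs + + 2 + + 2 ℤ.* ((+ 2 + + 2 ℤ.* v) - (v + fm + + 2 ℤ.* g))
  split = ℤ.solve-∀
  cancel : ∀ a w → a + + 2 ℤ.* (w - w) ≡ a
  cancel = ℤ.solve-∀

lemma2p4 : (V : ℕ) (G : MOGraph V) → Connected G → (g : ℕ) → IsGenus G g →
    (Λ G ≡ (+ V) - (+ (2 * Fs G)) + (+ 2))
    × (Λ G ≡ twoδ G - (+ (4 * g)))
    × (Λ G ≤ twoδ G)
lemma2p4 V G _ g genus = Λ-count , Λ-δ , Λ≤2δ
  where
  Λ-count : Λ G ≡ + V - + (2 * Fs G) + + 2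
  Λ-count = Λ≡V-2Fs+2 G
  Λ-δ : Λ G ≡ twoδ G - + (4 * g)
  Λ-δ = trans Λ-count (sym (twoδ-4g≡V-2Fs+2 G {g} genus))
  Λ≤2δ : Λ G ≤ twoδ G
  Λ≤2δ = subst (_≤ twoδ G) (sym Λ-δ) (ℤ.i-j≤i (twoδ G) (+ (4 * g)))
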